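{- Let $V$ be a set with $n\ge 3$ elements and let $\Pi=\{\mathcal{P}_1,\mathcal{P}_2,\mathcal{P}_3\}$ be a homogeneous $3$-scheme on $V$. Then $\{\mathcal{P}_1,\mathcal{P}_2\}$ is an association scheme, i.e. it is a homogeneous $2$-scheme satisfying the composition property: for any $P_i,P_j,P_k\in\mathcal{P}_2$, the number $\#\{\gamma\in V : (\alpha,\gamma)\in P_i \text{ and } (\gamma,\beta)\in P_j\}$ is the same for all $(\alpha,\beta)\in P_k$.
   Context: For $1\le s\le n$, $V^{(s)}$ denotes the set of $s$-tuples of pairwise distinct elements of $V$ (so $V^{(1)}=V$). For $s>1$ and $1\le i\le s$, $\pi^s_i:V^{(s)}\to V^{(s-1)}$ deletes the $i$-th coordinate. $\mathrm{Symm}_s$ acts on $V^{(s)}$ by $(v_1,\dots,v_s)^\sigma=(v_{1^\sigma},\dots,v_{s^\sigma})$. For $1\le m\le n$, an $m$-collection on $V$ is a family $\{\mathcal{P}_1,\dots,\mathcal{P}_m\}$ where $\mathcal{P}_s$ is a partition of $V^{(s)}$. It is: compatible at level $s>1$ if whenever $\bar u,\bar v$ lie in the same class of $\mathcal{P}_s$, for every $i$ the tuples $\pi^s_i(\bar u),\pi^s_i(\bar v)$ lie in the same class of $\mathcal{P}_{s-1}$; regular at level $s>1$ if whenever $\bar u,\bar v$ lie in the same class of $\mathcal{P}_{s-1}$, then for every $1\le i\le s$ and every $P\in\mathcal{P}_s$, $\#\{\bar u'\in P:\pi^s_i(\bar u')=\bar u\}=\#\{\bar v'\in P:\pi^s_i(\bar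 v')=\bar v\}$; invariant at level $s>1$ if $P^\sigma=\{\bar v^\sigma:\bar v\in P\}\in\mathcal{P}_s$ for all $P\in\mathcal{P}_s$, $\sigma\in\mathrm{Symm}_s$. An $m$-scheme is an $m$-collection that is compatible, regular and invariant at every level $1<s\le m$. It is homogeneous if $|\mathcal{P}_1|=1$. -}

module Defs where

open import Data.Nat using (ℕ; zero; suc; _≤_)
open import Data.Fin using (Fin)
import Data.Fin.Properties as FinP
open import Data.Fin.Permutation using (Permutation′; _⟨$⟩ʳ_)
open import Data.Vec using (Vec; []; _∷_; removeAt; lookup; tabulate; toList)
import Data.Vec.Properties as VecP
open import Data.List using (List; []; _∷_; length; filter; concatMap; map; allFin)
open import Data.List.Relation.Unary.Unique.Propositional using (Unique)
import Data.List.Relation.Unary.Unique.DecPropositional as UD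
open import Data.Product using (Σ; ∃; _×_; _,_)
open import Function.Bundles using (_⇔_)
open import Relation.Binary.PropositionalEquality using (_≡_)
open import Relation.Nullary using (Dec)
open import Relation.Nullary.Decidable using (_×-dec_)
import Data.Nat.Properties as NatP

module _ (n : ℕ) where

  -- V = Fin n.  An s-tuple of elements of V; it lies in V^(s) iff Distinct.
  Tup : ℕ → Set
  Tup s = Vec (Fin n) s

  Distinct : ∀ {s} → Tup s → Set
  Distinct v = Unique (toList v)

  distinct? : ∀ {s} (v : Tup s) → Dec (Distinct v)
  distinct? v = UD.unique? FinP._≟_ (toList v)

  allTuples : (s : ℕ) → List (Tup s)
  allTuples zero    = [] ∷ []
  allTuples (suc s) =
    concatMap (λ x → map (x ∷_) (allTuples s)) (allFin n)

  -- A partition of V^(s) is encoded by a labelling κ : Tup s → ℕ ;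
  -- the classes are the nonempty fibres {v ∈ V^(s) | κ v ≡ ℓ}.
  -- (Values of κ on non-distinct tuples are irrelevant.)
  Labelling : ℕ → Set
  Labelling s = Tup s → ℕ

  -- A collection: a labelling at every level s (only levels 1..m are used).
  Collection : Set
  Collection = (s : ℕ) → Labelling s

  act : ∀ {s} → Tup s → Permutation′ s → Tup s
  act v σ = tabulate (λ j → lookup v (σ ⟨$⟩ʳ j))

  Compatible : ∀ {s} → Labelling (suc s) → Labelling s → Set
  Compatible {s} κ' κ = ∀ (u v : Tup (suc s)) → Distinct u → Distinct v →
    κ' u ≡ κ' v → ∀ (i : Fin (suc s)) → κ (removeAt u i) ≡ κ (removeAt v i)

  fibreCount : ∀ {s} → Labelling (suc s) → ℕ → Fin (suc s) → Tup s → ℕ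
  fibreCount {s} κ' ℓ i u = length (filter
    (λ w → distinct? w ×-dec (κ' w NatP.≟ ℓ) ×-dec VecP.≡-dec FinP._≟_ (removeAt w i) u)
    (allTuples (suc s)))

  Regular : ∀ {s} → Labelling (suc s) → Labelling s → Set
  Regular {s} κ' κ = ∀ (u v : Tup s) → Distinct u → Distinct v →
    κ u ≡ κ v → ∀ (i : Fin (suc s)) (ℓ : ℕ) → fibreCount κ' ℓ i u ≡ fibreCount κ' ℓ i v

  Invariant : ∀ {s} → Labelling s → Set
  Invariant {s} κ = ∀ (σ : Permutation′ s) (ℓ : ℕ) →
    (∃ λ v → Distinct v × κ v ≡ ℓ) →
    ∃ λ ℓ' → ∀ (w : Tup s) → Distinct w →
      (κ w ≡ ℓ' ⇔ (∃ λ v → Distinct v × κ v ≡ ℓ × w ≡ act v σ))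

  IsScheme : ℕ → Collection → Set
  IsScheme m P = ∀ (s : ℕ) → 1 ≤ s → suc s ≤ m →
    Compatible (P (suc s)) (P s) × Regular (P (suc s)) (P s) × Invariant (P (suc s))

  -- homogeneous: |P₁| = 1 (V nonempty here), i.e. all 1-tuples share one class
  IsHomogeneous : Collection → Set
  IsHomogeneous P = ∀ (a b : Fin n) → P 1 (a ∷ []) ≡ P 1 (b ∷ [])

  compCount : Labelling 2 → ℕ → ℕ → Fin n → Fin n → ℕ
  compCount κ i j α β = length (filter
    (λ γ → (distinct? (α ∷ γ ∷ []) ×-dec (κ (α ∷ γ ∷ []) NatP.≟ i))
       ×-dec (distinct? (γ ∷ β ∷ []) ×-dec (κ (γ ∷ β ∷ []) NatP.≟ j)))
    (allFin n))

  IsAssociationScheme : Collection → Set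
  IsAssociationScheme P = (IsScheme 2 P × IsHomogeneous P) ×
    ∀ (i j k : ℕ) (α β α' β' : Fin n) →
      Distinct (α ∷ β ∷ []) → P 2 (α ∷ β ∷ []) ≡ k →
      Distinct (α' ∷ β' ∷ []) → P 2 (α' ∷ β' ∷ []) ≡ k →
      compCount (P 2) i j α β ≡ compCount (P 2) i j α' β'

module Submission where

-- Levels 1 and 2 of a 3-scheme already form a homogeneous
-- 2-scheme, so only the composition property needs an argument.  For a pair
-- (α,β) of distinct points call γ a middle point if (α,γ,β) is a triple of
-- distinct points, and give it the label of the 3-class of (α,γ,β).
--   * Regularity at level 3 in the middle coordinate says that, for every
--     label ℓ, the number of middle points with label ℓ depends only on the
--     2-class of (α,β): it is the size of a fibre of π₂ inside a 3-class.
--   * Compatibility at level 3 says that the label of γ determines the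
--     2-classes of (α,γ) and (γ,β), hence whether γ is counted by compCount.
-- A counting principle on lists ("same label profile + label-determined
-- predicate ⇒ same count") then yields the composition property.

open import Defs
open import Data.Nat using (ℕ; zero; suc; _+_; _≤_; s≤s; z≤n)
import Data.Nat.Properties as ℕP
open import Algebra.Properties.CommutativeSemigroup ℕP.+-commutativeSemigroup using (x∙yz≈y∙xz)
open import Data.Bool using (Bool; true; false; _∧_; T)
import Data.Bool.Properties as BoolP
open import Data.Fin using (Fin) renaming (zero to fzero; suc to fsuc)
import Data.Fin.Properties as FinP
open import Data.Vec using ([]; _∷_; removeAt; insertAt)
import Data.Vec.Properties as VecP
open import Data.List using (List; []; _∷_; _++_; map; concatMap; filter; length; allFin)
open import Data.List.Membership.Propositional using (_∈_)
open import Data.List.Membership.Propositional.Properties using (∈-filter⁻; ∈-allFin)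
open import Data.List.Relation.Unary.Any using (here; there)
open import Data.List.Relation.Unary.All using (All; []; _∷_) renaming (lookup to All-lookup; map to All-map)
open import Data.List.Relation.Unary.AllPairs using ([]; _∷_)
open import Data.List.Relation.Unary.Unique.Propositional using (Unique)
open import Data.List.Relation.Unary.Unique.Propositional.Properties using (allFin⁺)
open import Data.Product using (_,_; proj₁; proj₂)
open import Function.Bundles using (Equivalence)
open import Relation.Binary.PropositionalEquality
  using (_≡_; _≢_; refl; sym; trans; cong; cong₂; subst; module ≡-Reasoning)
open import Relation.Nullary using (Dec; yes; no; does)
open import Relation.Nullary.Decidable using (dec-true; dec-false; toWitness; fromWitness; isYes≗does)
open import Data.Empty using (⊥-elim)
open import Data.Unit using (tt)

open ≡-Reasoning

χ : Bool → ℕ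
χ true  = 1
χ false = 0

count : {A : Set} → (A → Bool) → List A → ℕ
count p []       = 0
count p (x ∷ xs) = χ (p x) + count p xs

count-cong : {A : Set} {p q : A → Bool} → (∀ x → p x ≡ q x) →
  ∀ xs → count p xs ≡ count q xs
count-cong p≡q []       = refl
count-cong p≡q (x ∷ xs) = cong₂ _+_ (cong χ (p≡q x)) (count-cong p≡q xs)

count-false : {A : Set} {p : A → Bool} → (∀ x → p x ≡ false) →
  ∀ xs → count p xs ≡ 0
count-false p≡false []       = refl
count-false p≡false (x ∷ xs) = cong₂ _+_ (cong χ (p≡false x)) (count-false p≡false xs)

length-filter : {A : Set} {P : A → Set} (P? : ∀ x → Dec (P x)) (xs : List A) →
  length (filter P? xs) ≡ count (λ x → does (P? x)) xs
length-filter P? []       = refl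
length-filter P? (x ∷ xs) with does (P? x)
... | true  = cong suc (length-filter P? xs)
... | false = length-filter P? xs

count-filter : {A : Set} {P : A → Set} (P? : ∀ x → Dec (P x)) (p : A → Bool) (xs : List A) →
  count p (filter P? xs) ≡ count (λ x → does (P? x) ∧ p x) xs
count-filter P? p []       = refl
count-filter P? p (x ∷ xs) with does (P? x)
... | true  = cong (χ (p x) +_) (count-filter P? p xs)
... | false = count-filter P? p xs

∧-implied : (a b : Bool) → (T b → T a) → a ∧ b ≡ b
∧-implied a     false _   = BoolP.∧-zeroʳ a
∧-implied true  true  _   = refl
∧-implied false true  b⇒a = ⊥-elim (b⇒a tt)

count-∧-implied : {A : Set} (d p : A → Bool) → (∀ x → T (p x) → T (d x)) →
  ∀ xs → count (λ x → d x ∧ p x) xs ≡ count p xs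
count-∧-implied d p p⇒d = count-cong (λ x → ∧-implied (d x) (p x) (p⇒d x))

count-map : {A B : Set} (p : B → Bool) (h : A → B) (xs : List A) →
  count p (map h xs) ≡ count (λ x → p (h x)) xs
count-map p h []       = refl
count-map p h (x ∷ xs) = cong (χ (p (h x)) +_) (count-map p h xs)

count-++ : {A : Set} (p : A → Bool) (xs ys : List A) →
  count p (xs ++ ys) ≡ count p xs + count p ys
count-++ p []       ys = refl
count-++ p (x ∷ xs) ys = begin
  χ (p x) + count p (xs ++ ys)        ≡⟨ cong (χ (p x) +_) (count-++ p xs ys) ⟩
  χ (p x) + (count p xs + count p ys) ≡⟨ ℕP.+-assoc (χ (p x)) _ _ ⟨
  χ (p x) + count p xs + count p ys   ∎

count-concatMap : {A B : Set} (p : B → Bool) (p′ : A → Bool) (h : A → List B) →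
  (∀ x → count p (h x) ≡ χ (p′ x)) → ∀ xs → count p (concatMap h xs) ≡ count p′ xs
count-concatMap p p′ h block []       = refl
count-concatMap p p′ h block (x ∷ xs) = begin
  count p (h x ++ concatMap h xs)          ≡⟨ count-++ p (h x) _ ⟩
  count p (h x) + count p (concatMap h xs) ≡⟨ cong₂ _+_ (block x) (count-concatMap p p′ h block xs) ⟩
  χ (p′ x) + count p′ xs                   ∎

count-concatMap-vanish : {A B : Set} (p : B → Bool) (h : A → List B) (xs : List A) →
  All (λ x → count p (h x) ≡ 0) xs → count p (concatMap h xs) ≡ 0
count-concatMap-vanish p h []       []         = refl
count-concatMap-vanish p h (x ∷ xs) (hx ∷ hxs) =
  trans (count-++ p (h x) _) (cong₂ _+_ hx (count-concatMap-vanish p h xs hxs))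

count-concatMap-single : {A B : Set} (p : B → Bool) (h : A → List B) {a : A} (xs : List A) →
  Unique xs → a ∈ xs → (∀ x → x ≢ a → count p (h x) ≡ 0) →
  count p (concatMap h xs) ≡ count p (h a)
count-concatMap-single p h (x ∷ xs) (x∉xs ∷ _) (here refl) others = begin
  count p (h x ++ concatMap h xs)          ≡⟨ count-++ p (h x) _ ⟩
  count p (h x) + count p (concatMap h xs) ≡⟨ cong (count p (h x) +_) rest-vanishes ⟩
  count p (h x) + 0                        ≡⟨ ℕP.+-identityʳ _ ⟩
  count p (h x)                            ∎
  where
  rest-vanishes : count p (concatMap h xs) ≡ 0
  rest-vanishes = count-concatMap-vanish p h xs
    (All-map (λ {y} x≢y → others y (λ y≡x → x≢y (sym y≡x))) x∉xs)
count-concatMap-single p h (x ∷ xs) (x∉xs ∷ uniq) (there a∈xs) others = begin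
  count p (h x ++ concatMap h xs)          ≡⟨ count-++ p (h x) _ ⟩
  count p (h x) + count p (concatMap h xs) ≡⟨ cong (_+ count p (concatMap h xs)) (others x (All-lookup x∉xs a∈xs)) ⟩
  count p (concatMap h xs)                 ≡⟨ count-concatMap-single p h xs uniq a∈xs others ⟩
  count p (h _)                            ∎

does-sound : {A : Set} (a? : Dec A) → T (does a?) → A
does-sound a? holds = toWitness {a? = a?} (subst T (sym (isYes≗does a?)) holds)

does-complete : {A : Set} (a? : Dec A) → A → T (does a?)
does-complete a? a = subst T (isYes≗does a?) (fromWitness {a? = a?} a)

_==_ : ℕ → ℕ → Bool
k == ℓ = does (k ℕP.≟ ℓ)

==-refl : ∀ k → (k == k) ≡ true
==-refl k = dec-true (k ℕP.≟ k) refl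

module Tuples (n : ℕ) where

  _=ᵖ_ : Fin n → Fin n → Bool
  x =ᵖ y = does (x FinP.≟ y)

  _=ᵗ_ : ∀ {s} → Tup n s → Tup n s → Bool
  u =ᵗ v = does (VecP.≡-dec FinP._≟_ u v)

  count-allTuples-suc : ∀ s (p : Tup n (suc s) → Bool) (p′ : Fin n → Bool) →
    (∀ x → count (λ t → p (x ∷ t)) (allTuples n s) ≡ χ (p′ x)) →
    count p (allTuples n (suc s)) ≡ count p′ (allFin n)
  count-allTuples-suc s p p′ block =
    count-concatMap p p′ (λ x → map (x ∷_) (allTuples n s))
      (λ x → trans (count-map p (x ∷_) (allTuples n s)) (block x)) (allFin n)

  count-headed : ∀ s (p : Tup n (suc s) → Bool) (a : Fin n) →
    (∀ x t → x ≢ a → p (x ∷ t) ≡ false) →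
    count p (allTuples n (suc s)) ≡ count (λ t → p (a ∷ t)) (allTuples n s)
  count-headed s p a headed = begin
    count p (concatMap block (allFin n))
      ≡⟨ count-concatMap-single p block (allFin n) (allFin⁺ n) (∈-allFin a) block-vanishes ⟩
    count p (map (a ∷_) (allTuples n s))
      ≡⟨ count-map p (a ∷_) (allTuples n s) ⟩
    count (λ t → p (a ∷ t)) (allTuples n s) ∎
    where
    block : Fin n → List (Tup n (suc s))
    block x = map (x ∷_) (allTuples n s)
    block-vanishes : ∀ x → x ≢ a → count p (block x) ≡ 0
    block-vanishes x x≢a = trans (count-map p (x ∷_) (allTuples n s))
      (count-false (λ t → headed x t x≢a) (allTuples n s))

  count-point : ∀ s (r : Tup n s → Bool) (u : Tup n s) →
    count (λ t → r t ∧ (t =ᵗ u)) (allTuples n s) ≡ χ (r u)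
  count-point zero    r []      = trans (ℕP.+-identityʳ _) (cong χ (BoolP.∧-identityʳ (r [])))
  count-point (suc s) r (a ∷ u) = begin
    count (λ t → r t ∧ (t =ᵗ (a ∷ u))) (allTuples n (suc s))
      ≡⟨ count-headed s _ a (λ x t x≢a → head-mismatch {x} {t} (r (x ∷ t)) x≢a) ⟩
    count (λ t → r (a ∷ t) ∧ ((a =ᵖ a) ∧ (t =ᵗ u))) (allTuples n s)
      ≡⟨ count-cong (λ t → cong (λ b → r (a ∷ t) ∧ (b ∧ (t =ᵗ u))) (dec-true (a FinP.≟ a) refl)) (allTuples n s) ⟩
    count (λ t → r (a ∷ t) ∧ (t =ᵗ u)) (allTuples n s)
      ≡⟨ count-point s (λ t → r (a ∷ t)) u ⟩
    χ (r (a ∷ u)) ∎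
    where
    head-mismatch : ∀ {x t} b → x ≢ a → b ∧ ((x =ᵖ a) ∧ (t =ᵗ u)) ≡ false
    head-mismatch {x} b x≢a =
      trans (cong (λ c → b ∧ (c ∧ _)) (dec-false (x FinP.≟ a) x≢a)) (BoolP.∧-zeroʳ b)

  removeAt-suc : ∀ {s} (x : Fin n) (t : Tup n (suc s)) (i : Fin (suc s)) →
    removeAt (x ∷ t) (fsuc i) ≡ x ∷ removeAt t i
  removeAt-suc x (y ∷ t) i = refl

  -- Counting over a fibre of π_i: the tuples w with removeAt w i ≡ u are
  -- exactly the tuples insertAt u i γ, one for each point γ.
  count-fibre : ∀ {s} (q : Tup n (suc s) → Bool) (i : Fin (suc s)) (u : Tup n s) →
    count (λ w → q w ∧ (removeAt w i =ᵗ u)) (allTuples n (suc s))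
      ≡ count (λ γ → q (insertAt u i γ)) (allFin n)
  count-fibre {s} q fzero u =
    count-allTuples-suc s _ _ (λ x → count-point s (λ t → q (x ∷ t)) u)
  count-fibre {suc s} q (fsuc i) (a ∷ u) = begin
    count (λ w → q w ∧ (removeAt w (fsuc i) =ᵗ (a ∷ u))) (allTuples n (suc (suc s)))
      ≡⟨ count-headed (suc s) _ a outside-block ⟩
    count (λ t → q (a ∷ t) ∧ (removeAt (a ∷ t) (fsuc i) =ᵗ (a ∷ u))) (allTuples n (suc s))
      ≡⟨ count-cong inside-block (allTuples n (suc s)) ⟩
    count (λ t → q (a ∷ t) ∧ (removeAt t i =ᵗ u)) (allTuples n (suc s))
      ≡⟨ count-fibre (λ t → q (a ∷ t)) i u ⟩
    count (λ γ → q (a ∷ insertAt u i γ)) (allFin n) ∎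
    where
    removed : ∀ x t → (removeAt (x ∷ t) (fsuc i) =ᵗ (a ∷ u)) ≡ (x =ᵖ a) ∧ (removeAt t i =ᵗ u)
    removed x t = cong (_=ᵗ (a ∷ u)) (removeAt-suc x t i)
    outside-block : ∀ x t → x ≢ a → q (x ∷ t) ∧ (removeAt (x ∷ t) (fsuc i) =ᵗ (a ∷ u)) ≡ false
    outside-block x t x≢a = begin
      q (x ∷ t) ∧ (removeAt (x ∷ t) (fsuc i) =ᵗ (a ∷ u)) ≡⟨ cong (q (x ∷ t) ∧_) (removed x t) ⟩
      q (x ∷ t) ∧ ((x =ᵖ a) ∧ (removeAt t i =ᵗ u))       ≡⟨ cong (λ c → q (x ∷ t) ∧ (c ∧ _)) (dec-false (x FinP.≟ a) x≢a) ⟩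
      q (x ∷ t) ∧ false                                  ≡⟨ BoolP.∧-zeroʳ _ ⟩
      false                                              ∎
    inside-block : ∀ t → q (a ∷ t) ∧ (removeAt (a ∷ t) (fsuc i) =ᵗ (a ∷ u)) ≡ q (a ∷ t) ∧ (removeAt t i =ᵗ u)
    inside-block t = cong (q (a ∷ t) ∧_)
      (trans (removed a t) (cong (_∧ (removeAt t i =ᵗ u)) (dec-true (a FinP.≟ a) refl)))

  inClass : ∀ {s} → Labelling n s → ℕ → Tup n s → Bool
  inClass κ ℓ w = does (distinct? n w) ∧ (κ w == ℓ)

  inClass-distinct : ∀ {s} (κ : Labelling n s) (ℓ : ℕ) (w : Tup n s) → T (inClass κ ℓ w) → Distinct n w
  inClass-distinct κ ℓ w holds = does-sound (distinct? n w) (proj₁ (Equivalence.to BoolP.T-∧ holds))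

  inClass-cong : ∀ {s} (κ : Labelling n s) (ℓ : ℕ) {u v : Tup n s} →
    Distinct n u → Distinct n v → κ u ≡ κ v → inClass κ ℓ u ≡ inClass κ ℓ v
  inClass-cong κ ℓ {u} {v} du dv κu≡κv =
    cong₂ _∧_ (trans (dec-true (distinct? n u) du) (sym (dec-true (distinct? n v) dv)))
              (cong (_== ℓ) κu≡κv)

  fibreCount-insertAt : ∀ {s} (κ : Labelling n (suc s)) (ℓ : ℕ) (i : Fin (suc s)) (u : Tup n s) →
    fibreCount n κ ℓ i u ≡ count (λ γ → inClass κ ℓ (insertAt u i γ)) (allFin n)
  fibreCount-insertAt {s} κ ℓ i u = begin
    fibreCount n κ ℓ i u
      ≡⟨ length-filter _ (allTuples n (suc s)) ⟩
    count (λ w → does (distinct? n w) ∧ ((κ w == ℓ) ∧ (removeAt w i =ᵗ u))) (allTuples n (suc s))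
      ≡⟨ count-cong (λ w → BoolP.∧-assoc (does (distinct? n w)) (κ w == ℓ) (removeAt w i =ᵗ u)) (allTuples n (suc s)) ⟨
    count (λ w → inClass κ ℓ w ∧ (removeAt w i =ᵗ u)) (allTuples n (suc s))
      ≡⟨ count-fibre (inClass κ ℓ) i u ⟩
    count (λ γ → inClass κ ℓ (insertAt u i γ)) (allFin n) ∎

module LabelledLists {X Y : Set} (f : X → ℕ) (g : Y → ℕ) where

  SameProfile : List X → List Y → Set
  SameProfile xs ys = ∀ ℓ → count (λ x → f x == ℓ) xs ≡ count (λ y → g y == ℓ) ys

  record Split (ℓ : ℕ) (ys : List Y) : Set where
    field
      elem        : Y
      rest        : List Y
      elem-label  : g elem ≡ ℓ
      elem-∈      : elem ∈ ys
      rest-⊆      : ∀ {z} → z ∈ rest → z ∈ ys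
      count-split : ∀ p → count p ys ≡ χ (p elem) + count p rest

  split : ∀ ℓ ys → 1 ≤ count (λ y → g y == ℓ) ys → Split ℓ ys
  split ℓ []       ()
  split ℓ (y ∷ ys) occurs with g y ℕP.≟ ℓ
  ... | yes gy≡ℓ = record
    { elem = y ; rest = ys ; elem-label = gy≡ℓ ; elem-∈ = here refl
    ; rest-⊆ = there ; count-split = λ p → refl }
  ... | no gy≢ℓ = record
    { elem = elem ; rest = y ∷ rest ; elem-label = elem-label ; elem-∈ = there elem-∈
    ; rest-⊆ = λ { (here z≡y) → here z≡y ; (there z∈rest) → there (rest-⊆ z∈rest) }
    ; count-split = λ p → trans (cong (χ (p y) +_) (count-split p)) (x∙yz≈y∙xz (χ (p y)) (χ (p elem)) _) }
    where
    occurs-later : 1 ≤ count (λ z → g z == ℓ) ys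
    occurs-later = subst (λ b → 1 ≤ χ b + count (λ z → g z == ℓ) ys) (dec-false (g y ℕP.≟ ℓ) gy≢ℓ) occurs
    open Split (split ℓ ys occurs-later)

  -- The counting principle; proved by pairing each element of xs with an
  -- element of ys of the same label and removing both.
  count-transfer : (p : X → Bool) (q : Y → Bool) (xs : List X) (ys : List Y) →
    SameProfile xs ys →
    (∀ {x y} → x ∈ xs → y ∈ ys → f x ≡ g y → p x ≡ q y) →
    count p xs ≡ count q ys
  count-transfer p q [] [] same determined = refl
  count-transfer p q [] (y ∷ ys) same determined = ⊥-elim (ℕP.0≢1+n absent)
    where
    absent : 0 ≡ suc (count (λ z → g z == g y) ys)
    absent = trans (same (g y)) (cong (λ b → χ b + count (λ z → g z == g y) ys) (==-refl (g y)))
  count-transfer p q (x ∷ xs) ys same determined = begin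
    χ (p x) + count p xs     ≡⟨ cong₂ _+_ (cong χ (determined (here refl) elem-∈ (sym elem-label))) rest-transfer ⟩
    χ (q elem) + count q rest ≡⟨ count-split q ⟨
    count q ys               ∎
    where
    occurs : 1 ≤ count (λ y → g y == f x) ys
    occurs = subst (1 ≤_) (trans (cong (λ b → χ b + count (λ z → f z == f x) xs) (sym (==-refl (f x))))
                                 (same (f x))) (s≤s z≤n)
    open Split (split (f x) ys occurs)
    rest-same : SameProfile xs rest
    rest-same ℓ = ℕP.+-cancelˡ-≡ (χ (f x == ℓ)) _ _ (begin
      χ (f x == ℓ) + count (λ z → f z == ℓ) xs ≡⟨ same ℓ ⟩
      count (λ z → g z == ℓ) ys               ≡⟨ count-split (λ z → g z == ℓ) ⟩
      χ (g elem == ℓ) + count (λ z → g z == ℓ) rest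
        ≡⟨ cong (λ k → χ (k == ℓ) + count (λ z → g z == ℓ) rest) elem-label ⟩
      χ (f x == ℓ) + count (λ z → g z == ℓ) rest ∎)
    rest-transfer : count p xs ≡ count q rest
    rest-transfer = count-transfer p q xs rest rest-same
      (λ x∈xs y∈rest → determined (there x∈xs) (rest-⊆ y∈rest))

module SmallTuples {n : ℕ} where

  pair-distinct : {a b : Fin n} → Distinct n (a ∷ b ∷ []) → a ≢ b
  pair-distinct ((a≢b ∷ []) ∷ [] ∷ []) = a≢b

  distinct-pair : {a b : Fin n} → a ≢ b → Distinct n (a ∷ b ∷ [])
  distinct-pair a≢b = (a≢b ∷ []) ∷ [] ∷ []

  distinct-triple : {a b c : Fin n} → a ≢ b → a ≢ c → b ≢ c → Distinct n (a ∷ b ∷ c ∷ [])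
  distinct-triple a≢b a≢c b≢c = (a≢b ∷ a≢c ∷ []) ∷ (b≢c ∷ []) ∷ [] ∷ []

  front-pair : {a b c : Fin n} → Distinct n (a ∷ b ∷ c ∷ []) → Distinct n (a ∷ b ∷ [])
  front-pair ((a≢b ∷ _) ∷ _) = distinct-pair a≢b

  back-pair : {a b c : Fin n} → Distinct n (a ∷ b ∷ c ∷ []) → Distinct n (b ∷ c ∷ [])
  back-pair (_ ∷ bc) = bc

module Composition (n : ℕ) (P : Collection n) where
  open Tuples n
  open SmallTuples

  middle : Fin n → Fin n → List (Fin n)
  middle α β = filter (λ γ → distinct? n (α ∷ γ ∷ β ∷ [])) (allFin n)

  apex : Fin n → Fin n → Fin n → ℕ
  apex α β γ = P 3 (α ∷ γ ∷ β ∷ [])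

  path : ℕ → ℕ → Fin n → Fin n → Fin n → Bool
  path i j α β γ = inClass (P 2) i (α ∷ γ ∷ []) ∧ inClass (P 2) j (γ ∷ β ∷ [])

  middle-labels : ∀ α β ℓ →
    count (λ γ → apex α β γ == ℓ) (middle α β) ≡ fibreCount n (P 3) ℓ (fsuc fzero) (α ∷ β ∷ [])
  middle-labels α β ℓ = trans (count-filter _ (λ γ → apex α β γ == ℓ) (allFin n))
    (sym (fibreCount-insertAt (P 3) ℓ (fsuc fzero) (α ∷ β ∷ [])))

  -- For α ≠ β every point counted by compCount is a middle point.
  compCount-middle : ∀ i j α β → α ≢ β →
    compCount n (P 2) i j α β ≡ count (path i j α β) (middle α β)
  compCount-middle i j α β α≢β = begin
    compCount n (P 2) i j α β
      ≡⟨ length-filter _ (allFin n) ⟩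
    count (path i j α β) (allFin n)
      ≡⟨ count-∧-implied isMiddle (path i j α β) path⇒middle (allFin n) ⟨
    count (λ γ → isMiddle γ ∧ path i j α β γ) (allFin n)
      ≡⟨ count-filter _ (path i j α β) (allFin n) ⟨
    count (path i j α β) (middle α β) ∎
    where
    isMiddle : Fin n → Bool
    isMiddle γ = does (distinct? n (α ∷ γ ∷ β ∷ []))
    path⇒middle : ∀ γ → T (path i j α β γ) → T (isMiddle γ)
    path⇒middle γ holds = does-complete (distinct? n (α ∷ γ ∷ β ∷ [])) (distinct-triple
      (pair-distinct (inClass-distinct (P 2) i (α ∷ γ ∷ []) first))
      α≢β
      (pair-distinct (inClass-distinct (P 2) j (γ ∷ β ∷ []) second)))
      where
      first : T (inClass (P 2) i (α ∷ γ ∷ []))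
      first = proj₁ (Equivalence.to (BoolP.T-∧ {inClass (P 2) i (α ∷ γ ∷ [])}) holds)
      second : T (inClass (P 2) j (γ ∷ β ∷ []))
      second = proj₂ (Equivalence.to (BoolP.T-∧ {inClass (P 2) i (α ∷ γ ∷ [])}) holds)

  path-determined : Compatible n (P 3) (P 2) → ∀ i j {α β α′ β′ γ γ′} →
    γ ∈ middle α β → γ′ ∈ middle α′ β′ → apex α β γ ≡ apex α′ β′ γ′ →
    path i j α β γ ≡ path i j α′ β′ γ′
  path-determined compatible i j {α} {β} {α′} {β′} {γ} {γ′} γ∈ γ′∈ same-apex =
    cong₂ _∧_
      (inClass-cong (P 2) i (front-pair αγβ) (front-pair α′γ′β′) (same-face (fsuc (fsuc fzero))))
      (inClass-cong (P 2) j (back-pair αγβ) (back-pair α′γ′β′) (same-face fzero))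
    where
    αγβ : Distinct n (α ∷ γ ∷ β ∷ [])
    αγβ    = proj₂ (∈-filter⁻ (λ γ → distinct? n (α ∷ γ ∷ β ∷ [])) {xs = allFin n} γ∈)
    α′γ′β′ : Distinct n (α′ ∷ γ′ ∷ β′ ∷ [])
    α′γ′β′ = proj₂ (∈-filter⁻ (λ γ → distinct? n (α′ ∷ γ ∷ β′ ∷ [])) {xs = allFin n} γ′∈)
    same-face : ∀ k → P 2 (removeAt (α ∷ γ ∷ β ∷ []) k) ≡ P 2 (removeAt (α′ ∷ γ′ ∷ β′ ∷ []) k)
    same-face = compatible _ _ αγβ α′γ′β′ same-apex

  composition : Compatible n (P 3) (P 2) → Regular n (P 3) (P 2) →
    ∀ i j k α β α′ β′ →
    Distinct n (α ∷ β ∷ []) → P 2 (α ∷ β ∷ []) ≡ k →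
    Distinct n (α′ ∷ β′ ∷ []) → P 2 (α′ ∷ β′ ∷ []) ≡ k →
    compCount n (P 2) i j α β ≡ compCount n (P 2) i j α′ β′
  composition compatible regular i j k α β α′ β′ αβ class αβ′ class′ = begin
    compCount n (P 2) i j α β
      ≡⟨ compCount-middle i j α β (pair-distinct αβ) ⟩
    count (path i j α β) (middle α β)
      ≡⟨ count-transfer (path i j α β) (path i j α′ β′) (middle α β) (middle α′ β′)
           same-profile (path-determined compatible i j) ⟩
    count (path i j α′ β′) (middle α′ β′)
      ≡⟨ compCount-middle i j α′ β′ (pair-distinct αβ′) ⟨
    compCount n (P 2) i j α′ β′ ∎
    where
    open LabelledLists (apex α β) (apex α′ β′)
    same-profile : SameProfile (middle α β) (middle α′ β′)
    same-profile ℓ = begin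
      count (λ γ → apex α β γ == ℓ) (middle α β)      ≡⟨ middle-labels α β ℓ ⟩
      fibreCount n (P 3) ℓ (fsuc fzero) (α ∷ β ∷ [])   ≡⟨ regular _ _ αβ αβ′ (trans class (sym class′)) (fsuc fzero) ℓ ⟩
      fibreCount n (P 3) ℓ (fsuc fzero) (α′ ∷ β′ ∷ []) ≡⟨ middle-labels α′ β′ ℓ ⟨
      count (λ γ → apex α′ β′ γ == ℓ) (middle α′ β′)  ∎

truncate-scheme : ∀ n m (P : Collection n) → 2 ≤ m → IsScheme n m P → IsScheme n 2 P
truncate-scheme n m P 2≤m scheme s 1≤s s+1≤2 = scheme s 1≤s (ℕP.≤-trans s+1≤2 2≤m)

mainTheorem2 : (n : ℕ) → 3 ≤ n → (P : Collection n) →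
    IsScheme n 3 P → IsHomogeneous n P → IsAssociationScheme n P
mainTheorem2 n _ P scheme homogeneous =
  (truncate-scheme n 3 P (ℕP.n≤1+n 2) scheme , homogeneous) ,
  Composition.composition n P compatible regular
  where
  compatible : Compatible n (P 3) (P 2)
  compatible = proj₁ (scheme 2 (s≤s z≤n) ℕP.≤-refl)
  regular : Regular n (P 3) (P 2)
  regular = proj₁ (proj₂ (scheme 2 (s≤s z≤n) ℕP.≤-refl))
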